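{- For every integer $n\ge 2$, $\gamma(cDB^+(n,n,n))=\lceil n/2\rceil\,(n-1)!$.
   Context: Let $[d]=\{1,\dots,d\}$. A sequence $(x_1,\dots,x_n)\in[d]^n$ is $t$-constrained if for all $1\le i<j\le n$ with $x_i=x_j$ one has $j-i\ge t$; thus $V(n,n,n)$, the set of $n$-constrained sequences in $[n]^n$, is the set of permutations of $[n]$. The directed graph $cDB^+(d,t,n)$ has vertex set $V(d,t,n)$ (the $t$-constrained sequences in $[d]^n$) and an arc from $(a_1,\dots,a_n)$ to $(a_2,\dots,a_n,a_{n+1})$ whenever both lie in $V(d,t,n)$. In a directed graph a vertex dominates itself and its out-neighbours; a dominating set is a set $S$ of vertices such that every vertex is dominated by some vertex of $S$, and $\gamma(G)$ is the minimum size of a dominating set. -}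

module Defs where

open import Data.Nat using (ℕ; suc; _≤_; _<_; _∸_)
open import Data.Fin using (Fin; toℕ)
open import Data.Vec using (Vec; lookup; tail; _∷ʳ_)
open import Data.List using (List; length)
open import Data.List.Relation.Unary.All using (All)
open import Data.List.Relation.Unary.Any using (Any)
open import Data.List.Relation.Unary.Unique.Propositional using (Unique)
open import Data.Product using (Σ; _×_)
open import Data.Sum using (_⊎_)
open import Relation.Binary.PropositionalEquality using (_≡_)

-- a sequence (x_1,…,x_n) ∈ [d]^n, with [d] represented by Fin d
Seq : ℕ → ℕ → Set
Seq d n = Vec (Fin d) n

TConstrained : {d n : ℕ} → ℕ → Seq d n → Set
TConstrained {d} {n} t x =
  (i j : Fin n) → toℕ i < toℕ j → lookup x i ≡ lookup x j → t ≤ toℕ j ∸ toℕ i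

InV : (d t n : ℕ) → Seq d n → Set
InV d t n x = TConstrained {d} {n} t x

Arc : (d t n : ℕ) → Seq d n → Seq d n → Set
Arc d t n a b = InV d t n a × InV d t n b × Σ (Fin d) (λ c → tail (a ∷ʳ c) ≡ b)

Dominates : (d t n : ℕ) → Seq d n → Seq d n → Set
Dominates d t n u v = (u ≡ v) ⊎ Arc d t n u v

IsDominatingSet : (d t n : ℕ) → List (Seq d n) → Set
IsDominatingSet d t n S =
  All (InV d t n) S ×
  ((v : Seq d n) → InV d t n v → Any (λ u → Dominates d t n u v) S)

DominationNumber : (d t n m : ℕ) → Set
DominationNumber d t n m =
  Σ (List (Seq d n)) (λ S → IsDominatingSet d t n S × Unique S × length S ≡ m) ×
  ((S : List (Seq d n)) → IsDominatingSet d t n S → m ≤ length S)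

module Submission where

-- The vertices of cDB⁺(n,n,n) are the permutations of [n]. Appending a symbol to the tail of a
-- permutation gives a permutation only if the symbol is the one just dropped, so the arcs are
-- exactly the cyclic rotations and the graph is a disjoint union of (n−1)! directed n-cycles, one
-- per rotation class (represented by the permutation that starts with 0). Taking every second
-- vertex of each cycle dominates it with ⌈n/2⌉ vertices. Conversely a vertex dominates only itself
-- and its successor on its cycle, so the dominators lying on one cycle can be labelled so that
-- each of the ⌈n/2⌉ labels is used; comparing the set of (cycle, label) pairs with a dominating
-- set S gives |S| ≥ ⌈n/2⌉ (n−1)!.

open import Defs
open import Data.Bool using (Bool; true; false)
open import Data.Empty using (⊥-elim)
open import Data.Fin using (Fin; zero; suc; toℕ; fromℕ; inject₁; punchOut)
open import Data.Fin.Properties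
  using (toℕ-injective; toℕ<n; toℕ-fromℕ<; toℕ-fromℕ; toℕ-inject₁; any?; pigeonhole; punchOut-injective; <⇒≢)
  renaming (_≟_ to _≟ᶠ_)
import Data.Fin.Properties as Fin
open import Data.Fin.Relation.Unary.Top using (view; ‵fromℕ; ‵inject₁)
open import Data.List using (List; []; _∷_; [_]; length; map; concatMap; cartesianProduct; allFin; upTo)
open import Data.List.Properties
  using (length-map; length-++; length-removeAt′; length-tabulate; length-upTo; map-∘; map-id-local)
open import Data.List.Membership.Propositional using (_∈_; _∉_; find; lose)
open import Data.List.Membership.Propositional.Properties
  using ( ∈-map⁺; ∈-map⁻; ∈-concatMap⁺; ∈-concatMap⁻; ∈-allFin; ∈-upTo⁺; ∈-upTo⁻
        ; ∈-cartesianProduct⁺; ∈-cartesianProduct⁻)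
open import Data.List.Relation.Binary.Permutation.Propositional
  using (_↭_; ↭-refl; ↭-sym; ↭-trans; ↭-prep; ↭-swap; ↭⇒↭ₛ)
open import Data.List.Relation.Binary.Permutation.Propositional.Properties using (∈-resp-↭; ↭-length)
import Data.List.Relation.Binary.Permutation.Setoid.Properties as ↭ₛ
open import Data.List.Relation.Binary.Subset.Propositional using (_⊆_)
open import Data.List.Relation.Unary.All using (All; []; _∷_)
import Data.List.Relation.Unary.All as All
import Data.List.Relation.Unary.All.Properties as All
open import Data.List.Relation.Unary.AllPairs using (AllPairs; []; _∷_)
import Data.List.Relation.Unary.AllPairs as AllPairs
import Data.List.Relation.Unary.AllPairs.Properties as AllPairs
open import Data.List.Relation.Unary.Any using (Any; here; there; _─_; index)
open import Data.List.Relation.Unary.Unique.Propositional using (Unique)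
import Data.List.Relation.Unary.Unique.Propositional.Properties as Unique
open import Data.Nat
  using (ℕ; zero; suc; _+_; _*_; _∸_; _≤_; _<_; z≤n; s≤s; z<s; s<s; _%_; _/_; _!; ⌊_/2⌋; ⌈_/2⌉; _<?_)
open import Data.Nat.DivMod using (_mod_; m%n<n; m<n⇒m%n≡m; n%n≡0; [m+n]%n≡m%n; [m+kn]%n≡m%n; m≡m%n+[m/n]*n)
open import Data.Nat.Properties
  using ( +-suc; *-comm; +-identityʳ; suc-injective; ≤-pred; ≤-refl; <⇒≤; <-cmp; <-irrefl; <-trans
        ; <-≤-trans; ≤-<-trans; <⇒≱; n<1+n; m∸n≤m; m∸n+n≡m; m∸[m∸n]≡n; +-∸-assoc; m≤n⇒m<n∨m≡n
        ; n≡⌊n+n/2⌋; n≡⌈n+n/2⌉; ⌊n/2⌋-mono)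
open import Data.Product using (∃-syntax; _×_; _,_; proj₁; proj₂; map₂)
open import Data.Sum using (_⊎_; inj₁; inj₂; map₁)
open import Data.Vec using (Vec; []; _∷_; lookup; head; tail; _∷ʳ_)
open import Data.Vec.Properties using (∷-injectiveʳ; ∷ʳ-injective; tabulate∘lookup; tabulate-cong; ≡-dec)
open import Function using (_∘_)
open import Relation.Nullary using (¬_; Dec; yes; no; does)
open import Relation.Binary.Definitions using (tri<; tri≈; tri>)
open import Relation.Binary.PropositionalEquality
  using (_≡_; _≢_; ≢-sym; refl; sym; trans; cong; cong₂; subst; subst₂; setoid; module ≡-Reasoning)

private
  variable
    A B : Set
    k : ℕ

length-concatMap : (f : A → List B) {c : ℕ} (xs : List A) →
                   (∀ {x} → x ∈ xs → length (f x) ≡ c) → length (concatMap f xs) ≡ length xs * c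
length-concatMap f []       _  = refl
length-concatMap f (x ∷ xs) lf =
  trans (length-++ (f x)) (cong₂ _+_ (lf (here refl)) (length-concatMap f xs (lf ∘ there)))

length-cartesianProduct : (xs : List A) (ys : List B) →
                          length (cartesianProduct xs ys) ≡ length xs * length ys
length-cartesianProduct []       ys = refl
length-cartesianProduct (x ∷ xs) ys =
  trans (length-++ (map (x ,_) ys)) (cong₂ _+_ (length-map _ ys) (length-cartesianProduct xs ys))

∈-─⁺ : {x y : A} {xs : List A} (x∈xs : x ∈ xs) → y ∈ xs → y ≢ x → y ∈ (xs ─ x∈xs)
∈-─⁺ (here refl) (here refl) y≢x = ⊥-elim (y≢x refl)
∈-─⁺ (here refl) (there y∈) _    = y∈
∈-─⁺ (there x∈)  (here refl) _   = here refl
∈-─⁺ (there x∈)  (there y∈) y≢x  = there (∈-─⁺ x∈ y∈ y≢x)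

Unique-⊆⇒length≤ : {xs ys : List A} → Unique xs → xs ⊆ ys → length xs ≤ length ys
Unique-⊆⇒length≤ []          _ = z≤n
Unique-⊆⇒length≤ {xs = x ∷ xs} {ys} (x≢xs ∷ xs!) x∷xs⊆ys =
  subst (length (x ∷ xs) ≤_) (sym (length-removeAt′ ys (index x∈ys))) (s≤s (Unique-⊆⇒length≤ xs! xs⊆ys─x))
  where
  x∈ys : x ∈ ys
  x∈ys = x∷xs⊆ys (here refl)
  xs⊆ys─x : xs ⊆ (ys ─ x∈ys)
  xs⊆ys─x y∈xs = ∈-─⁺ x∈ys (x∷xs⊆ys (there y∈xs)) (≢-sym (All.lookup x≢xs y∈xs))

Unique-resp-↭ : {xs ys : List A} → xs ↭ ys → Unique xs → Unique ys
Unique-resp-↭ {A = A} p = ↭ₛ.Unique-resp-↭ (setoid A) (↭⇒↭ₛ p)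

selections : List A → List (A × List A)
selections []       = []
selections (x ∷ xs) = (x , xs) ∷ map (map₂ (x ∷_)) (selections xs)

selections-↭ : {x : A} {r xs : List A} → (x , r) ∈ selections xs → x ∷ r ↭ xs
selections-↭ {xs = y ∷ ys} (here refl) = ↭-refl
selections-↭ {xs = y ∷ ys} (there s∈) with ∈-map⁻ (map₂ (y ∷_)) s∈
... | (x , r) , s∈′ , refl = ↭-trans (↭-swap x y ↭-refl) (↭-prep y (selections-↭ s∈′))

∈-selections⁺ : {x : A} {xs : List A} → x ∈ xs → ∃[ r ] (x , r) ∈ selections xs
∈-selections⁺ (here refl) = _ , here refl
∈-selections⁺ (there x∈) with ∈-selections⁺ x∈
... | r , s∈ = _ , there (∈-map⁺ (map₂ (_ ∷_)) s∈)

map-proj₁-selections : (xs : List A) → map proj₁ (selections xs) ≡ xs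
map-proj₁-selections []       = refl
map-proj₁-selections (x ∷ xs) =
  cong (x ∷_) (trans (sym (map-∘ (selections xs))) (map-proj₁-selections xs))

length-selections : (xs : List A) → length (selections xs) ≡ length xs
length-selections xs = trans (sym (length-map proj₁ (selections xs))) (cong length (map-proj₁-selections xs))

Distinct : Vec A k → Set
Distinct v = ∀ {i j} → lookup v i ≡ lookup v j → i ≡ j

∷-distinct : {x : A} {w : Vec A k} → (∀ j → lookup w j ≢ x) → Distinct w → Distinct (x ∷ w)
∷-distinct x∉w w! {zero}  {zero}  _ = refl
∷-distinct x∉w w! {zero}  {suc j} e = ⊥-elim (x∉w j (sym e))
∷-distinct x∉w w! {suc i} {zero}  e = ⊥-elim (x∉w i e)
∷-distinct x∉w w! {suc i} {suc j} e = cong suc (w! e)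

distinct-tail : (x : A) (w : Vec A k) → Distinct (x ∷ w) → Distinct w
distinct-tail _ _ x∷w! e = Fin.suc-injective (x∷w! e)

distinct-head : (x : A) (w : Vec A k) → Distinct (x ∷ w) → ∀ j → lookup w j ≢ x
distinct-head _ _ x∷w! j e with x∷w! {suc j} {zero} e
... | ()

arrangements : (k : ℕ) → List A → List (Vec A k)
arrangements zero    xs = [ [] ]
arrangements (suc k) xs = concatMap (λ s → map (proj₁ s ∷_) (arrangements k (proj₂ s))) (selections xs)

length-arrangements : (xs : List A) → length xs ≡ k → length (arrangements k xs) ≡ k !
length-arrangements {k = zero}  xs _    = refl
length-arrangements {k = suc k} xs ∣xs∣ =
  trans (length-concatMap _ (selections xs) block-length) (cong (_* k !) (trans (length-selections xs) ∣xs∣))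
  where
  block-length : ∀ {s} → s ∈ selections xs → length (map (proj₁ s ∷_) (arrangements k (proj₂ s))) ≡ k !
  block-length {x , r} s∈ = trans (length-map _ (arrangements k r))
    (length-arrangements r (suc-injective (trans (↭-length (selections-↭ s∈)) ∣xs∣)))

∈-arrangements-suc⁻ : {xs : List A} {v : Vec A (suc k)} → v ∈ arrangements (suc k) xs →
                      ∃[ x ] ∃[ r ] ∃[ w ] ((x , r) ∈ selections xs × w ∈ arrangements k r × v ≡ x ∷ w)
∈-arrangements-suc⁻ {xs = xs} v∈ with find (∈-concatMap⁻ _ {xs = selections xs} v∈)
... | (x , r) , s∈ , v∈block with ∈-map⁻ (x ∷_) v∈block
... | w , w∈ , v≡x∷w = x , r , w , s∈ , w∈ , v≡x∷w

∈-arrangements⁻ : {xs : List A} {v : Vec A k} → v ∈ arrangements k xs → ∀ i → lookup v i ∈ xs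
∈-arrangements⁻ {k = suc k} {xs} v∈ i with ∈-arrangements-suc⁻ {xs = xs} v∈
∈-arrangements⁻ v∈ zero    | x , r , w , s∈ , w∈ , refl = ∈-resp-↭ (selections-↭ s∈) (here refl)
∈-arrangements⁻ v∈ (suc j) | x , r , w , s∈ , w∈ , refl =
  ∈-resp-↭ (selections-↭ s∈) (there (∈-arrangements⁻ w∈ j))

arrangements-distinct : {xs : List A} {v : Vec A k} → Unique xs → v ∈ arrangements k xs → Distinct v
arrangements-distinct {k = zero}  _   _  {()}
arrangements-distinct {k = suc k} {xs} xs! v∈ with ∈-arrangements-suc⁻ {xs = xs} v∈
... | x , r , w , s∈ , w∈ , refl with Unique-resp-↭ (↭-sym (selections-↭ s∈)) xs!
...   | x≢r ∷ r! =
  ∷-distinct (λ j e → All.lookup x≢r (∈-arrangements⁻ w∈ j) (sym e)) (arrangements-distinct r! w∈)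

∈-arrangements⁺ : {xs : List A} (v : Vec A k) → Distinct v → (∀ i → lookup v i ∈ xs) →
                  v ∈ arrangements k xs
∈-arrangements⁺ []      _  _  = here refl
∈-arrangements⁺ {xs = xs} (x ∷ w) x∷w! x∷w⊆xs with ∈-selections⁺ (x∷w⊆xs zero)
... | r , s∈ = ∈-concatMap⁺ _ (lose s∈ (∈-map⁺ (x ∷_) (∈-arrangements⁺ w (distinct-tail x w x∷w!) w⊆r)))
  where
  w⊆r : ∀ j → lookup w j ∈ r
  w⊆r j with ∈-resp-↭ (↭-sym (selections-↭ s∈)) (x∷w⊆xs (suc j))
  ... | here e     = ⊥-elim (distinct-head x w x∷w! j e)
  ... | there wⱼ∈r = wⱼ∈r

arrangements-unique : {xs : List A} → Unique xs → Unique (arrangements k xs)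
arrangements-unique {k = zero}  _   = [] ∷ []
arrangements-unique {k = suc k} {xs} xs! =
  Unique.concat⁺ (All.map⁺ (All.tabulate block-unique))
                 (AllPairs.map⁺ (AllPairs.map blocks-disjoint heads-distinct))
  where
  block : A × List A → List (Vec A (suc k))
  block s = map (proj₁ s ∷_) (arrangements k (proj₂ s))

  block-unique : ∀ {s} → s ∈ selections xs → Unique (block s)
  block-unique {x , r} s∈ with Unique-resp-↭ (↭-sym (selections-↭ s∈)) xs!
  ... | _ ∷ r! = Unique.map⁺ ∷-injectiveʳ (arrangements-unique r!)

  heads-distinct : AllPairs (λ s t → proj₁ s ≢ proj₁ t) (selections xs)
  heads-distinct = AllPairs.map⁻ (subst Unique (sym (map-proj₁-selections xs)) xs!)

  blocks-disjoint : ∀ {s t} → proj₁ s ≢ proj₁ t → ∀ {v} → ¬ (v ∈ block s × v ∈ block t)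
  blocks-disjoint x≢y (v∈ , v∈′) with ∈-map⁻ _ v∈ | ∈-map⁻ _ v∈′
  ... | _ , _ , refl | _ , _ , e = x≢y (cong head e)

distinct-misses-nothing : (v : Vec (Fin (suc k)) (suc k)) → Distinct v →
                          (a : Fin (suc k)) → ¬ (∀ i → a ≢ lookup v i)
distinct-misses-nothing {k} v v! a a∉v with pigeonhole (n<1+n k) (λ i → punchOut (a∉v i))
... | i , j , i<j , eq = <⇒≢ i<j (v! (punchOut-injective (a∉v i) (a∉v j) eq))

distinct-surjective : {n : ℕ} (v : Vec (Fin n) n) → Distinct v → ∀ a → ∃[ i ] lookup v i ≡ a
distinct-surjective {suc _} v v! a with any? (λ i → lookup v i ≟ᶠ a)
... | yes found = found
... | no a∉v    = ⊥-elim (distinct-misses-nothing v v! a (λ i a≡vᵢ → a∉v (i , sym a≡vᵢ)))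

gap<bound : {n t : ℕ} → n ≤ t → (i j : Fin n) → toℕ j ∸ toℕ i < t
gap<bound n≤t i j = <-≤-trans (≤-<-trans (m∸n≤m (toℕ j) (toℕ i)) (toℕ<n j)) n≤t

constrained⇒distinct : {d n t : ℕ} (x : Seq d n) → n ≤ t → TConstrained t x → Distinct x
constrained⇒distinct x n≤t x-ok {i} {j} xᵢ≡xⱼ with <-cmp (toℕ i) (toℕ j)
... | tri< i<j _ _ = ⊥-elim (<⇒≱ (gap<bound n≤t i j) (x-ok i j i<j xᵢ≡xⱼ))
... | tri≈ _ i≡j _ = toℕ-injective i≡j
... | tri> _ _ j<i = ⊥-elim (<⇒≱ (gap<bound n≤t j i) (x-ok j i j<i (sym xᵢ≡xⱼ)))

distinct⇒constrained : {d n : ℕ} (t : ℕ) (x : Seq d n) → Distinct x → TConstrained t x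
distinct⇒constrained t x x! i j i<j xᵢ≡xⱼ with x! xᵢ≡xⱼ
... | refl = ⊥-elim (<-irrefl refl i<j)

lookup-∷ʳ-inject₁ : (xs : Vec A k) (x : A) (i : Fin k) → lookup (xs ∷ʳ x) (inject₁ i) ≡ lookup xs i
lookup-∷ʳ-inject₁ (y ∷ xs) x zero    = refl
lookup-∷ʳ-inject₁ (y ∷ xs) x (suc i) = lookup-∷ʳ-inject₁ xs x i

lookup-∷ʳ-fromℕ : (xs : Vec A k) (x : A) → lookup (xs ∷ʳ x) (fromℕ k) ≡ x
lookup-∷ʳ-fromℕ []       x = refl
lookup-∷ʳ-fromℕ (y ∷ xs) x = lookup-∷ʳ-fromℕ xs x

lookup-ext : {u v : Vec A k} → (∀ i → lookup u i ≡ lookup v i) → u ≡ v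
lookup-ext {u = u} {v} u≗v = trans (sym (tabulate∘lookup u)) (trans (tabulate-cong u≗v) (tabulate∘lookup v))

module Rotation (m : ℕ) where

  n : ℕ
  n = suc m

  toℕ-mod : (j : ℕ) → toℕ (j mod n) ≡ j % n
  toℕ-mod j = toℕ-fromℕ< (m%n<n j n)

  mod-cong : (j j′ : ℕ) → j % n ≡ j′ % n → j mod n ≡ j′ mod n
  mod-cong j j′ e = toℕ-injective (trans (toℕ-mod j) (trans e (sym (toℕ-mod j′))))

  toℕ-mod-id : (i : Fin n) → toℕ i mod n ≡ i
  toℕ-mod-id i = toℕ-injective (trans (toℕ-mod (toℕ i)) (m<n⇒m%n≡m (toℕ<n i)))

  suc-% : (j : ℕ) → suc j % n ≡ suc (j % n) % n
  suc-% j = trans (cong (λ t → suc t % n) (m≡m%n+[m/n]*n j n)) ([m+kn]%n≡m%n (suc (j % n)) (j / n) n)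

  at : Vec A n → ℕ → A
  at v j = lookup v (j mod n)

  at-lookup : (v : Vec A n) (i : Fin n) → at v (toℕ i) ≡ lookup v i
  at-lookup v i = cong (lookup v) (toℕ-mod-id i)

  at-+n : (v : Vec A n) (j : ℕ) → at v (j + n) ≡ at v j
  at-+n v j = cong (lookup v) (mod-cong (j + n) j ([m+n]%n≡m%n j n))

  at-ext : {u v : Vec A n} → (∀ j → at u j ≡ at v j) → u ≡ v
  at-ext {u = u} {v} u≗v =
    lookup-ext (λ i → trans (sym (at-lookup u i)) (trans (u≗v (toℕ i)) (at-lookup v i)))

  rot : Vec A n → Vec A n
  rot v = tail (v ∷ʳ head v)

  lookup-rot : (v : Vec A n) (i : Fin n) → lookup (rot v) i ≡ at v (suc (toℕ i))
  lookup-rot (x ∷ xs) i with view i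
  ... | ‵fromℕ = trans (lookup-∷ʳ-fromℕ xs x) (cong (lookup (x ∷ xs)) (sym last+1≡0))
    where
    last+1≡0 : suc (toℕ (fromℕ m)) mod n ≡ zero
    last+1≡0 = toℕ-injective (trans (toℕ-mod (suc (toℕ (fromℕ m))))
                                    (trans (cong (λ t → suc t % n) (toℕ-fromℕ m)) (n%n≡0 n)))
  ... | ‵inject₁ t = trans (lookup-∷ʳ-inject₁ xs x t) (cong (lookup (x ∷ xs)) (sym t+1≡suc))
    where
    t+1≡suc : suc (toℕ (inject₁ t)) mod n ≡ suc t
    t+1≡suc = trans (cong (λ a → suc a mod n) (toℕ-inject₁ t)) (toℕ-mod-id (suc t))

  at-rot : (v : Vec A n) (j : ℕ) → at (rot v) j ≡ at v (suc j)
  at-rot v j = trans (lookup-rot v (j mod n)) (cong (lookup v) (mod-cong (suc (toℕ (j mod n))) (suc j) residues))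
    where
    residues : suc (toℕ (j mod n)) % n ≡ suc j % n
    residues = trans (cong (λ t → suc t % n) (toℕ-mod j)) (sym (suc-% j))

  rot^ : ℕ → Vec A n → Vec A n
  rot^ zero    v = v
  rot^ (suc k) v = rot (rot^ k v)

  at-rot^ : (k : ℕ) (v : Vec A n) (j : ℕ) → at (rot^ k v) j ≡ at v (j + k)
  at-rot^ zero    v j = cong (at v) (sym (+-identityʳ j))
  at-rot^ (suc k) v j =
    trans (at-rot (rot^ k v) j) (trans (at-rot^ k v (suc j)) (cong (at v) (sym (+-suc j k))))

  rot^-+ : (a b : ℕ) (v : Vec A n) → rot^ a (rot^ b v) ≡ rot^ (a + b) v
  rot^-+ zero    b v = refl
  rot^-+ (suc a) b v = cong rot (rot^-+ a b v)

  rot^-n : (v : Vec A n) → rot^ n v ≡ v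
  rot^-n v = at-ext (λ j → trans (at-rot^ n v j) (at-+n v j))

  rot-injective : {u w : Vec A n} → rot u ≡ rot w → u ≡ w
  rot-injective {u = x ∷ xs} {y ∷ ys} e with ∷ʳ-injective xs ys e
  ... | refl , refl = refl

  rot-distinct : (v : Vec A n) → Distinct v → Distinct (rot v)
  rot-distinct (x ∷ xs) x∷xs! {i} {j} e with view i | view j
  ... | ‵fromℕ     | ‵fromℕ     = refl
  ... | ‵fromℕ     | ‵inject₁ b = ⊥-elim (distinct-head x xs x∷xs! b
    (sym (trans (sym (lookup-∷ʳ-fromℕ xs x)) (trans e (lookup-∷ʳ-inject₁ xs x b)))))
  ... | ‵inject₁ a | ‵fromℕ     = ⊥-elim (distinct-head x xs x∷xs! a
    (trans (sym (lookup-∷ʳ-inject₁ xs x a)) (trans e (lookup-∷ʳ-fromℕ xs x))))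
  ... | ‵inject₁ a | ‵inject₁ b = cong inject₁ (distinct-tail x xs x∷xs!
    (trans (sym (lookup-∷ʳ-inject₁ xs x a)) (trans e (lookup-∷ʳ-inject₁ xs x b))))

  rot^-distinct : (k : ℕ) (v : Vec A n) → Distinct v → Distinct (rot^ k v)
  rot^-distinct zero    v v! = v!
  rot^-distinct (suc k) v v! = rot-distinct (rot^ k v) (rot^-distinct k v v!)

m<⌈n/2⌉⇒m+m<n : ∀ {i n} → i < ⌈ n /2⌉ → i + i < n
m<⌈n/2⌉⇒m+m<n {zero}  {suc n}       _           = z<s
m<⌈n/2⌉⇒m+m<n {suc i} {suc (suc n)} (s≤s i<⌈n/2⌉)
  rewrite +-suc i i = s<s (s<s (m<⌈n/2⌉⇒m+m<n i<⌈n/2⌉))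

m+m<n⇒m<⌈n/2⌉ : ∀ {i n} → i + i < n → i < ⌈ n /2⌉
m+m<n⇒m<⌈n/2⌉ {zero}  {suc n}       _           = z<s
m+m<n⇒m<⌈n/2⌉ {suc i} {suc (suc n)} (s≤s 2i+1<n)
  rewrite +-suc i i = s<s (m+m<n⇒m<⌈n/2⌉ (≤-pred 2i+1<n))

even-or-odd : (k : ℕ) → k ≡ ⌊ k /2⌋ + ⌊ k /2⌋ ⊎ k ≡ suc (⌊ k /2⌋ + ⌊ k /2⌋)
even-or-odd zero          = inj₁ refl
even-or-odd (suc zero)    = inj₂ refl
even-or-odd (suc (suc k)) with even-or-odd k
... | inj₁ e = inj₁ (cong suc (trans (cong suc e) (sym (+-suc ⌊ k /2⌋ ⌊ k /2⌋))))
... | inj₂ e = inj₂ (cong (λ t → suc (suc t)) (trans e (sym (+-suc ⌊ k /2⌋ ⌊ k /2⌋))))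

-- Positions 0,…,m of a directed (m+1)-cycle; D marks the chosen ones, and position k+1 is
-- dominated by k or k+1. With label ⌈k/2⌉ when 0 is chosen (⌊k/2⌋ otherwise), both possible
-- dominators of position 2i (2i+1 otherwise) carry label i; if 0 is not chosen and m = 2i, the
-- dominator m of position 0 carries it.
cycleLabel : Bool → ℕ → ℕ
cycleLabel true  k = ⌈ k /2⌉
cycleLabel false k = ⌊ k /2⌋

cycle-labels-dominated : {m : ℕ} (D : ℕ → Set) (D₀? : Dec (D 0)) →
                         D 0 ⊎ D m → (∀ {k} → k < m → D (suc k) ⊎ D k) →
                         ∀ {i} → i < ⌈ suc m /2⌉ → ∃[ k ] (k < suc m × D k × cycleLabel (does D₀?) k ≡ i)
cycle-labels-dominated D (yes D₀) _ _ {zero} _ = 0 , z<s , D₀ , refl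
cycle-labels-dominated D (yes D₀) _ dom-suc {suc i} i<⌈n/2⌉ with dom-suc (≤-pred (m<⌈n/2⌉⇒m+m<n i<⌈n/2⌉))
... | inj₁ D₂ᵢ   = suc (i + suc i) , m<⌈n/2⌉⇒m+m<n i<⌈n/2⌉ , D₂ᵢ , sym (n≡⌈n+n/2⌉ (suc i))
... | inj₂ D₂ᵢ₋₁ = i + suc i , <-trans (n<1+n _) (m<⌈n/2⌉⇒m+m<n i<⌈n/2⌉) , D₂ᵢ₋₁ , sym (n≡⌊n+n/2⌋ (suc i))
cycle-labels-dominated {m} D (no ¬D₀) dom-0 dom-suc {i} i<⌈n/2⌉ with suc (i + i) <? suc m
... | yes 2i+1<n with dom-suc (≤-pred 2i+1<n)
...   | inj₁ D₂ᵢ₊₁ = suc (i + i) , 2i+1<n , D₂ᵢ₊₁ , sym (n≡⌈n+n/2⌉ i)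
...   | inj₂ D₂ᵢ   = i + i , m<⌈n/2⌉⇒m+m<n i<⌈n/2⌉ , D₂ᵢ , sym (n≡⌊n+n/2⌋ i)
cycle-labels-dominated {m} D (no ¬D₀) (inj₁ D₀) _ _ | no _ = ⊥-elim (¬D₀ D₀)
cycle-labels-dominated {m} D (no ¬D₀) (inj₂ Dₘ) _ {i} i<⌈n/2⌉ | no 2i+1≮n =
  m , n<1+n m , Dₘ , subst (λ t → ⌊ t /2⌋ ≡ i) 2i≡m (sym (n≡⌊n+n/2⌋ i))
  where
  2i≡m : i + i ≡ m
  2i≡m with m≤n⇒m<n∨m≡n (≤-pred (m<⌈n/2⌉⇒m+m<n i<⌈n/2⌉))
  ... | inj₁ 2i<m = ⊥-elim (2i+1≮n (s<s 2i<m))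
  ... | inj₂ 2i≡m = 2i≡m

zeroPosition : {n : ℕ} → Vec (Fin (suc n)) k → ℕ
zeroPosition []           = 0
zeroPosition (zero  ∷ _)  = 0
zeroPosition (suc _ ∷ xs) = suc (zeroPosition xs)

zeroPosition-lookup : {n : ℕ} (v : Vec (Fin (suc n)) k) → Distinct v →
                      ∀ {i} → lookup v i ≡ zero → zeroPosition v ≡ toℕ i
zeroPosition-lookup (zero  ∷ xs) _  {zero}  _  = refl
zeroPosition-lookup (zero  ∷ xs) v! {suc i} vᵢ≡0 with v! {zero} {suc i} (sym vᵢ≡0)
... | ()
zeroPosition-lookup (suc _ ∷ xs) v! {suc i} vᵢ≡0 =
  cong suc (zeroPosition-lookup xs (distinct-tail _ xs v!) vᵢ≡0)

module Permutations (m : ℕ) where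

  open Rotation m
  open import Data.List.Membership.DecPropositional (≡-dec {n = n} (_≟ᶠ_ {n})) using (_∈?_)

  V : Set
  V = Vec (Fin n) n

  rot-arc : (u : V) → Distinct u → Arc n n n u (rot u)
  rot-arc u u! = distinct⇒constrained n u u! , distinct⇒constrained n (rot u) (rot-distinct u u!) , head u , refl

  -- The dropped head x must reappear in the new permutation, and only the appended slot is free.
  arc⇒rot : (u w : V) → Arc n n n u w → w ≡ rot u
  arc⇒rot (x ∷ xs) _ (u-ok , w-ok , c , refl)
    with distinct-surjective (xs ∷ʳ c) (constrained⇒distinct (xs ∷ʳ c) ≤-refl w-ok) x
  ... | i , wᵢ≡x with view i
  ...   | ‵fromℕ     = cong (xs ∷ʳ_) (trans (sym (lookup-∷ʳ-fromℕ xs c)) wᵢ≡x)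
  ...   | ‵inject₁ j = ⊥-elim (distinct-head x xs (constrained⇒distinct (x ∷ xs) ≤-refl u-ok) j
                                               (trans (sym (lookup-∷ʳ-inject₁ xs c j)) wᵢ≡x))

  dominator-of-rot : (u w : V) → Dominates n n n u (rot w) → u ≡ rot w ⊎ u ≡ w
  dominator-of-rot u w (inj₁ u≡rot-w) = inj₁ u≡rot-w
  dominator-of-rot u w (inj₂ arc)     = inj₂ (rot-injective (sym (arc⇒rot u (rot w) arc)))

  dominating-rot : {S : List V} → IsDominatingSet n n n S → (w : V) → Distinct w → rot w ∈ S ⊎ w ∈ S
  dominating-rot (_ , S-dom) w w! with find (S-dom (rot w) (distinct⇒constrained n (rot w) (rot-distinct w w!)))
  ... | u , u∈S , u↦rot-w with dominator-of-rot u w u↦rot-w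
  ...   | inj₁ refl = inj₁ u∈S
  ...   | inj₂ refl = inj₂ u∈S

  -- (n ∸ k) % n, the amount of rotation undoing rot^ k
  negMod : ℕ → ℕ
  negMod zero    = 0
  negMod (suc k) = n ∸ suc k

  negMod<n : (k : ℕ) → negMod k < n
  negMod<n zero    = z<s
  negMod<n (suc k) = s≤s (m∸n≤m m k)

  rot^-negMod : (k : ℕ) → k < n → (v : V) → rot^ (negMod k) (rot^ k v) ≡ v
  rot^-negMod zero    _   v = refl
  rot^-negMod (suc k) k<n v = begin
    rot^ (n ∸ suc k) (rot^ (suc k) v) ≡⟨ rot^-+ (n ∸ suc k) (suc k) v ⟩
    rot^ (n ∸ suc k + suc k) v        ≡⟨ cong (λ t → rot^ t v) (m∸n+n≡m (<⇒≤ k<n)) ⟩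
    rot^ n v                          ≡⟨ rot^-n v ⟩
    v                                 ∎
    where open ≡-Reasoning

  at-negMod : (k : ℕ) → k < n → (v : V) → at v (negMod k + k) ≡ at v 0
  at-negMod zero    _   v = refl
  at-negMod (suc k) k<n v = trans (cong (at v) (m∸n+n≡m (<⇒≤ k<n))) (at-+n v 0)

  negMod-involutive : (k : ℕ) → k < n → negMod (negMod k) ≡ k
  negMod-involutive zero    _          = refl
  negMod-involutive (suc k) (s≤s k<m) rewrite +-∸-assoc 1 k<m = m∸[m∸n]≡n k<m

  Representative : V → Set
  Representative r = Distinct r × lookup r zero ≡ zero

  rep : V → V
  rep v = rot^ (zeroPosition v) v

  offset : V → ℕ
  offset v = negMod (zeroPosition v)

  zeroPosition-rot^ : (r : V) → Representative r → (k : ℕ) → k < n → zeroPosition (rot^ k r) ≡ negMod k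
  zeroPosition-rot^ r (r! , r₀≡0) k k<n =
    trans (zeroPosition-lookup (rot^ k r) (rot^-distinct k r r!) zero-at-negMod)
          (trans (toℕ-mod (negMod k)) (m<n⇒m%n≡m (negMod<n k)))
    where
    open ≡-Reasoning
    zero-at-negMod : at (rot^ k r) (negMod k) ≡ zero
    zero-at-negMod = begin
      at (rot^ k r) (negMod k) ≡⟨ at-rot^ k r (negMod k) ⟩
      at r (negMod k + k)      ≡⟨ at-negMod k k<n r ⟩
      at r 0                   ≡⟨ at-lookup r zero ⟩
      lookup r zero            ≡⟨ r₀≡0 ⟩
      zero                     ∎

  rep-rot^ : (r : V) → Representative r → (k : ℕ) → k < n → rep (rot^ k r) ≡ r
  rep-rot^ r r-rep k k<n =
    trans (cong (λ t → rot^ t (rot^ k r)) (zeroPosition-rot^ r r-rep k k<n)) (rot^-negMod k k<n r)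

  offset-rot^ : (r : V) → Representative r → (k : ℕ) → k < n → offset (rot^ k r) ≡ k
  offset-rot^ r r-rep k k<n = trans (cong negMod (zeroPosition-rot^ r r-rep k k<n)) (negMod-involutive k k<n)

  zeroPosition-spec : (v : V) → Distinct v → zeroPosition v < n × at v (zeroPosition v) ≡ zero
  zeroPosition-spec v v! with distinct-surjective v v! zero
  ... | i , vᵢ≡0 rewrite zeroPosition-lookup v v! vᵢ≡0 = toℕ<n i , trans (at-lookup v i) vᵢ≡0

  rep-representative : (v : V) → Distinct v → Representative (rep v)
  rep-representative v v! =
    rot^-distinct (zeroPosition v) v v! ,
    trans (sym (at-lookup (rep v) zero)) (trans (at-rot^ (zeroPosition v) v 0) (proj₂ (zeroPosition-spec v v!)))

  offset<n : (v : V) → offset v < n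
  offset<n v = negMod<n (zeroPosition v)

  rot^-offset-rep : (v : V) → Distinct v → rot^ (offset v) (rep v) ≡ v
  rot^-offset-rep v v! = rot^-negMod (zeroPosition v) (proj₁ (zeroPosition-spec v v!)) v

  nonzero : List (Fin n)
  nonzero = map suc (allFin m)

  nonzero-unique : Unique nonzero
  nonzero-unique = Unique.map⁺ Fin.suc-injective (Unique.allFin⁺ m)

  zero∉nonzero : zero ∉ nonzero
  zero∉nonzero 0∈ with ∈-map⁻ suc 0∈
  ... | _ , _ , ()

  representatives : List V
  representatives = map (zero ∷_) (arrangements m nonzero)

  length-representatives : length representatives ≡ m !
  length-representatives =
    trans (length-map _ (arrangements m nonzero))
          (length-arrangements {k = m} nonzero (trans (length-map suc (allFin m)) (length-tabulate (λ i → i))))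

  representatives-unique : Unique representatives
  representatives-unique = Unique.map⁺ ∷-injectiveʳ (arrangements-unique nonzero-unique)

  ∈-representatives⁻ : {r : V} → r ∈ representatives → Representative r
  ∈-representatives⁻ r∈ with ∈-map⁻ (zero ∷_) r∈
  ... | w , w∈ , refl = ∷-distinct zero∉w (arrangements-distinct nonzero-unique w∈) , refl
    where
    zero∉w : ∀ j → lookup w j ≢ zero
    zero∉w j wⱼ≡0 = zero∉nonzero (subst (_∈ nonzero) wⱼ≡0 (∈-arrangements⁻ w∈ j))

  ∈-representatives⁺ : (r : V) → Representative r → r ∈ representatives
  ∈-representatives⁺ (zero ∷ w) (r! , refl) =
    ∈-map⁺ (zero ∷_) (∈-arrangements⁺ w (distinct-tail zero w r!) w⊆nonzero)
    where
    w⊆nonzero : ∀ j → lookup w j ∈ nonzero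
    w⊆nonzero j with lookup w j in wⱼ≡
    ... | zero  = ⊥-elim (distinct-head zero w r! j wⱼ≡)
    ... | suc a = ∈-map⁺ suc (∈-allFin a)

  keys : List (V × ℕ)
  keys = cartesianProduct representatives (upTo ⌈ n /2⌉)

  keys-unique : Unique keys
  keys-unique = Unique.cartesianProduct⁺ representatives-unique (Unique.upTo⁺ ⌈ n /2⌉)

  length-keys : length keys ≡ ⌈ n /2⌉ * m !
  length-keys = begin
    length keys                                 ≡⟨ length-cartesianProduct representatives (upTo ⌈ n /2⌉) ⟩
    length representatives * length (upTo ⌈ n /2⌉) ≡⟨ cong₂ _*_ length-representatives (length-upTo ⌈ n /2⌉) ⟩
    m ! * ⌈ n /2⌉                               ≡⟨ *-comm (m !) ⌈ n /2⌉ ⟩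
    ⌈ n /2⌉ * m !                               ∎
    where open ≡-Reasoning

  ∈-keys⁻ : {r : V} {i : ℕ} → (r , i) ∈ keys → Representative r × i < ⌈ n /2⌉
  ∈-keys⁻ κ∈ with ∈-cartesianProduct⁻ representatives (upTo ⌈ n /2⌉) κ∈
  ... | r∈ , i∈ = ∈-representatives⁻ r∈ , ∈-upTo⁻ i∈

  evenRotation : V × ℕ → V
  evenRotation (r , i) = rot^ (i + i) r

  dominatingSet : List V
  dominatingSet = map evenRotation keys

  dominatingSet-vertices : All (InV n n n) dominatingSet
  dominatingSet-vertices = All.map⁺ (All.tabulate vertex)
    where
    vertex : ∀ {κ} → κ ∈ keys → InV n n n (evenRotation κ)
    vertex {r , i} κ∈ = distinct⇒constrained n (rot^ (i + i) r) (rot^-distinct (i + i) r (proj₁ (proj₁ (∈-keys⁻ κ∈))))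

  dominatingSet-dominates : (v : V) → InV n n n v → Any (λ u → Dominates n n n u v) dominatingSet
  dominatingSet-dominates v v-ok = lose (∈-map⁺ evenRotation κ∈) (dominates (even-or-odd (offset v)))
    where
    v! : Distinct v
    v! = constrained⇒distinct v ≤-refl v-ok
    r : V
    r = rep v
    i : ℕ
    i = ⌊ offset v /2⌋
    κ∈ : (r , i) ∈ keys
    κ∈ = ∈-cartesianProduct⁺ (∈-representatives⁺ r (rep-representative v v!))
                             (∈-upTo⁺ (s≤s (⌊n/2⌋-mono (≤-pred (offset<n v)))))
    rot^-r : ∀ {k} → offset v ≡ k → rot^ k r ≡ v
    rot^-r refl = rot^-offset-rep v v!
    dominates : offset v ≡ i + i ⊎ offset v ≡ suc (i + i) → Dominates n n n (rot^ (i + i) r) v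
    dominates (inj₁ even) = inj₁ (rot^-r even)
    dominates (inj₂ odd)  = inj₂ (subst (Arc n n n (rot^ (i + i) r)) (rot^-r odd)
                                        (rot-arc (rot^ (i + i) r) (rot^-distinct (i + i) r (proj₁ (rep-representative v v!)))))

  keyOf : V → V × ℕ
  keyOf v = rep v , ⌊ offset v /2⌋

  dominatingSet-unique : Unique dominatingSet
  dominatingSet-unique = Unique.map⁻ {f = keyOf} (subst Unique (sym keys-recovered) keys-unique)
    where
    keyOf-evenRotation : ∀ {κ} → κ ∈ keys → keyOf (evenRotation κ) ≡ κ
    keyOf-evenRotation {r , i} κ∈ with ∈-keys⁻ κ∈
    ... | r-rep , i<⌈n/2⌉ =
      cong₂ _,_ (rep-rot^ r r-rep (i + i) 2i<n)
                (trans (cong ⌊_/2⌋ (offset-rot^ r r-rep (i + i) 2i<n)) (sym (n≡⌊n+n/2⌋ i)))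
      where
      2i<n : i + i < n
      2i<n = m<⌈n/2⌉⇒m+m<n i<⌈n/2⌉
    keys-recovered : map keyOf dominatingSet ≡ keys
    keys-recovered = trans (sym (map-∘ keys)) (map-id-local (All.tabulate keyOf-evenRotation))

  module _ {S : List V} (S-dom : IsDominatingSet n n n S) where

    label : V → V × ℕ
    label u = rep u , cycleLabel (does (rep u ∈? S)) (offset u)

    label-rot^ : (r : V) → Representative r → (k : ℕ) → k < n →
                 label (rot^ k r) ≡ (r , cycleLabel (does (r ∈? S)) k)
    label-rot^ r r-rep k k<n =
      cong₂ (λ r′ k′ → r′ , cycleLabel (does (r′ ∈? S)) k′) (rep-rot^ r r-rep k k<n) (offset-rot^ r r-rep k k<n)

    orbit-labelled : (r : V) → Representative r → ∀ {i} → i < ⌈ n /2⌉ → (r , i) ∈ map label S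
    orbit-labelled r r-rep@(r! , _) {i} i<⌈n/2⌉ =
      labelled (cycle-labels-dominated (λ k → rot^ k r ∈ S) (r ∈? S) dominated-0 dominated-suc i<⌈n/2⌉)
      where
      dominated-0 : r ∈ S ⊎ rot^ m r ∈ S
      dominated-0 = map₁ (subst (_∈ S) (rot^-n r)) (dominating-rot S-dom (rot^ m r) (rot^-distinct m r r!))
      dominated-suc : ∀ {k} → k < m → rot^ (suc k) r ∈ S ⊎ rot^ k r ∈ S
      dominated-suc {k} _ = dominating-rot S-dom (rot^ k r) (rot^-distinct k r r!)
      labelled : ∃[ k ] (k < n × rot^ k r ∈ S × cycleLabel (does (r ∈? S)) k ≡ i) → (r , i) ∈ map label S
      labelled (k , k<n , rᵏ∈S , labelₖ≡i) =
        subst (_∈ map label S) (trans (label-rot^ r r-rep k k<n) (cong (r ,_) labelₖ≡i)) (∈-map⁺ label rᵏ∈S)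

    keys⊆labels : keys ⊆ map label S
    keys⊆labels {r , i} κ∈ = orbit-labelled r (proj₁ (∈-keys⁻ κ∈)) (proj₂ (∈-keys⁻ κ∈))

    lower-bound : ⌈ n /2⌉ * m ! ≤ length S
    lower-bound = subst₂ _≤_ length-keys (length-map label S) (Unique-⊆⇒length≤ keys-unique keys⊆labels)

  domination-number : DominationNumber n n n (⌈ n /2⌉ * m !)
  domination-number =
    ( dominatingSet
    , (dominatingSet-vertices , dominatingSet-dominates)
    , dominatingSet-unique
    , trans (length-map evenRotation keys) length-keys
    ) ,
    λ _ S-dom → lower-bound S-dom

theorem12 : (n : ℕ) → 2 ≤ n → DominationNumber n n n (⌈ n /2⌉ * (n ∸ 1) !)
theorem12 zero    ()
theorem12 (suc m) _ = Permutations.domination-number m
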